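{- For every $\alpha\in\{0,1,2\}^{\mathbb{N}}$, $\Phi(\alpha)\simeq\Phi(\rho(\alpha))$.
   Context: The setting is constructive. Real numbers are regular sequences of rationals $\langle r_n\rangle$ with $|r_n-r_{n+1}|\le 2^{ -(n+1)}$. Equality is $\langle r_n\rangle\simeq\langle q_n\rangle$ iff $\forall n\,|r_{n+1}-q_{n+1}|\le2^{ -n}$. For $s\in\{0,1,2\}^*$, define $N(\langle\rangle)=1$ and $N(s*\langle i\rangle)=2N(s)+(i-1)$. For $\alpha\in\{0,1,2\}^{\mathbb{N}}$, $\Phi(\alpha)=\langle2^{ -(n+1)}N(\overline{\alpha}n)\rangle_n$, where $\overline{\alpha}n$ is the initial segment of length $n$. Let $\rho\colon\{0,1,2\}^3\to\{0,1,2\}^3$ be the identity except on four patterns: - $\langle1,2,2\rangle\mapsto\langle2,0,2\rangle$, - $\langle0,2,2\rangle\mapsto\langle1,0,2\rangle$, - $\langle1,0,0\rangle\mapsto\langle0,2,0\rangle$, - $\langle2,0,0\rangle\mapsto\langle1,2,0\rangle$. Extend $\rho$ to $\rho\colon\{0,1,2\}^{\mathbb{N}}\to\{0,1,2\}^{\mathbb{N}}$ by $\rho(\alpha)(n)=(\sigma^n_\alpha)_0$, where $\sigma^0_\alpha=\rho(\alpha_0,\alpha_1,\alpha_2)$ and $\sigma^{n+1}_\alpha=\rho((\sigma^n_\alpha)_1,\alpha_{n+2},\alpha_{n+3})$. Here $(\cdot)_j$ denotes the $j$-th component of a triple. -}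

module Defs where

open import Data.Nat using (ℕ; zero; suc; NonZero)
import Data.Nat as ℕ
open import Data.Nat.Properties using (m^n≢0)
open import Data.Fin using (Fin; zero; suc)
open import Data.Integer using (ℤ; +_; -[1+_])
import Data.Integer as ℤ
open import Data.List using (List; []; _∷_; foldl; applyUpTo)
open import Data.Rational using (ℚ; _/_; _-_; ∣_∣; _≤_)
open import Data.Product using (_×_; _,_; proj₁; proj₂)

Trit : Set
Trit = Fin 3

pow2 : ℕ → ℕ
pow2 k = 2 ℕ.^ k

pow2-nonZero : ∀ k → NonZero (pow2 k)
pow2-nonZero k = m^n≢0 2 k

2^-_ : ℕ → ℚ
2^- k = _/_ (+ 1) (pow2 k) {{pow2-nonZero k}}

-- regular sequences of rationals (constructive reals)
Regular : (ℕ → ℚ) → Set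
Regular r = ∀ n → ∣ r n - r (suc n) ∣ ≤ 2^- (suc n)

_≃ℝ_ : (ℕ → ℚ) → (ℕ → ℚ) → Set
r ≃ℝ q = ∀ n → ∣ r (suc n) - q (suc n) ∣ ≤ 2^- n

digit : Trit → ℤ
digit zero = -[1+ 0 ]
digit (suc zero) = + 0
digit (suc (suc zero)) = + 1

N : List Trit → ℤ
N = foldl (λ acc i → + 2 ℤ.* acc ℤ.+ digit i) (+ 1)

initSeg : (ℕ → Trit) → ℕ → List Trit
initSeg α n = applyUpTo α n

Φ : (ℕ → Trit) → (ℕ → ℚ)
Φ α n = _/_ (N (initSeg α n)) (pow2 (suc n)) {{pow2-nonZero (suc n)}}

Triple : Set
Triple = Trit × Trit × Trit

ρ₃ : Trit → Trit → Trit → Triple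
ρ₃ (suc zero) (suc (suc zero)) (suc (suc zero)) = suc (suc zero) , zero , suc (suc zero)
ρ₃ zero (suc (suc zero)) (suc (suc zero)) = suc zero , zero , suc (suc zero)
ρ₃ (suc zero) zero zero = zero , suc (suc zero) , zero
ρ₃ (suc (suc zero)) zero zero = suc zero , suc (suc zero) , zero
ρ₃ a b c = a , b , c

σ : (ℕ → Trit) → ℕ → Triple
σ α zero = ρ₃ (α 0) (α 1) (α 2)
σ α (suc n) = ρ₃ (proj₁ (proj₂ (σ α n))) (α (suc (suc n))) (α (suc (suc (suc n))))

ρ : (ℕ → Trit) → (ℕ → Trit)
ρ α n = proj₁ (σ α n)

-- The transducer ρ rewrites its input two digits at a time: at step n it replaces the pair
-- (carry, α (n+1)) by (ρ α (n+1), next carry) without changing the value 2 d₀ + d₁ of the pair.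
-- Hence the prefix of α of length n+1, extended by α (n+1), has the same value as the prefix of
-- ρ α extended by the carry, so the two prefixes differ by at most one unit in their last place
-- and the rationals Φ α (n+1), Φ (ρ α) (n+1) are within 2^-(n+2).
module Submission where

open import Defs
open import Data.Nat using (ℕ; zero; suc; NonZero; z≤n; s≤s)
import Data.Nat as ℕ
import Data.Nat.Properties as ℕ
open import Data.Fin using (zero; suc)
open import Data.Integer using (ℤ; +_)
import Data.Integer as ℤ
import Data.Integer.Properties as ℤ
open import Data.Integer.Tactic.RingSolver using (solve-∀)
open import Data.List using (applyUpTo; _∷ʳ_)
open import Data.List.Properties using (foldl-∷ʳ; applyUpTo-∷ʳ)
open import Data.Product using (proj₁; proj₂)
open import Data.Rational using (_/_; _-_; ∣_∣; _≤_; toℚᵘ)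
import Data.Rational as ℚ
import Data.Rational.Properties as ℚ
open import Data.Rational.Unnormalised using (_≃_; *≤*) renaming (_≤_ to _≤ᵘ_)
import Data.Rational.Unnormalised as ℚᵘ
import Data.Rational.Unnormalised.Properties as ℚᵘ
open import Relation.Binary.PropositionalEquality

extend : ℤ → Trit → ℤ
extend v a = + 2 ℤ.* v ℤ.+ digit a

pairValue : Trit → Trit → ℤ
pairValue a b = + 2 ℤ.* digit a ℤ.+ digit b

extend-extend : ∀ v a b → extend (extend v a) b ≡ + 4 ℤ.* v ℤ.+ pairValue a b
extend-extend v a b = double-twice v (digit a) (digit b)
  where
  double-twice : ∀ v x y → + 2 ℤ.* (+ 2 ℤ.* v ℤ.+ x) ℤ.+ y ≡ + 4 ℤ.* v ℤ.+ (+ 2 ℤ.* x ℤ.+ y)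
  double-twice = solve-∀

∣digit∣≤1 : ∀ a → ℤ.∣ digit a ∣ ℕ.≤ 1
∣digit∣≤1 zero = s≤s z≤n
∣digit∣≤1 (suc zero) = z≤n
∣digit∣≤1 (suc (suc zero)) = s≤s z≤n

∣digit-digit∣≤2 : ∀ a b → ℤ.∣ digit a ℤ.- digit b ∣ ℕ.≤ 2
∣digit-digit∣≤2 a b =
  ℕ.≤-trans (ℤ.∣i-j∣≤∣i∣+∣j∣ (digit a) (digit b)) (ℕ.+-mono-≤ (∣digit∣≤1 a) (∣digit∣≤1 b))

N-initSeg-suc : ∀ α n → N (initSeg α (suc n)) ≡ extend (N (initSeg α n)) (α n)
N-initSeg-suc α n = begin
  N (applyUpTo α (suc n))          ≡⟨ cong N (applyUpTo-∷ʳ α n) ⟨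
  N (applyUpTo α n ∷ʳ α n)         ≡⟨ foldl-∷ʳ _ (+ 1) (α n) (applyUpTo α n) ⟩
  extend (N (applyUpTo α n)) (α n) ∎
  where open ≡-Reasoning

ρ₃-pairValue : ∀ a b c → pairValue (proj₁ (ρ₃ a b c)) (proj₁ (proj₂ (ρ₃ a b c))) ≡ pairValue a b
ρ₃-pairValue zero zero zero = refl
ρ₃-pairValue zero zero (suc zero) = refl
ρ₃-pairValue zero zero (suc (suc zero)) = refl
ρ₃-pairValue zero (suc zero) zero = refl
ρ₃-pairValue zero (suc zero) (suc zero) = refl
ρ₃-pairValue zero (suc zero) (suc (suc zero)) = refl
ρ₃-pairValue zero (suc (suc zero)) zero = refl
ρ₃-pairValue zero (suc (suc zero)) (suc zero) = refl
ρ₃-pairValue zero (suc (suc zero)) (suc (suc zero)) = refl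
ρ₃-pairValue (suc zero) zero zero = refl
ρ₃-pairValue (suc zero) zero (suc zero) = refl
ρ₃-pairValue (suc zero) zero (suc (suc zero)) = refl
ρ₃-pairValue (suc zero) (suc zero) zero = refl
ρ₃-pairValue (suc zero) (suc zero) (suc zero) = refl
ρ₃-pairValue (suc zero) (suc zero) (suc (suc zero)) = refl
ρ₃-pairValue (suc zero) (suc (suc zero)) zero = refl
ρ₃-pairValue (suc zero) (suc (suc zero)) (suc zero) = refl
ρ₃-pairValue (suc zero) (suc (suc zero)) (suc (suc zero)) = refl
ρ₃-pairValue (suc (suc zero)) zero zero = refl
ρ₃-pairValue (suc (suc zero)) zero (suc zero) = refl
ρ₃-pairValue (suc (suc zero)) zero (suc (suc zero)) = refl
ρ₃-pairValue (suc (suc zero)) (suc zero) zero = refl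
ρ₃-pairValue (suc (suc zero)) (suc zero) (suc zero) = refl
ρ₃-pairValue (suc (suc zero)) (suc zero) (suc (suc zero)) = refl
ρ₃-pairValue (suc (suc zero)) (suc (suc zero)) zero = refl
ρ₃-pairValue (suc (suc zero)) (suc (suc zero)) (suc zero) = refl
ρ₃-pairValue (suc (suc zero)) (suc (suc zero)) (suc (suc zero)) = refl

carry : (ℕ → Trit) → ℕ → Trit
carry α n = proj₁ (proj₂ (σ α n))

ρ-carry-invariant : ∀ α n →
  extend (N (initSeg (ρ α) (suc n))) (carry α n) ≡ extend (N (initSeg α (suc n))) (α (suc n))
ρ-carry-invariant α zero = begin
  extend (extend (+ 1) (ρ α 0)) (carry α 0)  ≡⟨ extend-extend (+ 1) (ρ α 0) (carry α 0) ⟩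
  + 4 ℤ.+ pairValue (ρ α 0) (carry α 0)      ≡⟨ cong (λ p → + 4 ℤ.+ p) (ρ₃-pairValue (α 0) (α 1) (α 2)) ⟩
  + 4 ℤ.+ pairValue (α 0) (α 1)              ≡⟨ extend-extend (+ 1) (α 0) (α 1) ⟨
  extend (extend (+ 1) (α 0)) (α 1)          ∎
  where open ≡-Reasoning
ρ-carry-invariant α (suc n) = begin
  extend (N (initSeg (ρ α) (2 ℕ.+ n))) (carry α (suc n))
    ≡⟨ cong (λ v → extend v (carry α (suc n))) (N-initSeg-suc (ρ α) (suc n)) ⟩
  extend (extend v (ρ α (suc n))) (carry α (suc n))
    ≡⟨ extend-extend v (ρ α (suc n)) (carry α (suc n)) ⟩
  + 4 ℤ.* v ℤ.+ pairValue (ρ α (suc n)) (carry α (suc n))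
    ≡⟨ cong (λ p → + 4 ℤ.* v ℤ.+ p) (ρ₃-pairValue (carry α n) (α (2 ℕ.+ n)) (α (3 ℕ.+ n))) ⟩
  + 4 ℤ.* v ℤ.+ pairValue (carry α n) (α (2 ℕ.+ n))
    ≡⟨ extend-extend v (carry α n) (α (2 ℕ.+ n)) ⟨
  extend (extend v (carry α n)) (α (2 ℕ.+ n))
    ≡⟨ cong (λ w → extend w (α (2 ℕ.+ n))) (ρ-carry-invariant α n) ⟩
  extend (extend (N (initSeg α (suc n))) (α (suc n))) (α (2 ℕ.+ n))
    ≡⟨ cong (λ w → extend w (α (2 ℕ.+ n))) (N-initSeg-suc α (suc n)) ⟨
  extend (N (initSeg α (2 ℕ.+ n))) (α (2 ℕ.+ n))
    ∎
  where
  open ≡-Reasoning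
  v = N (initSeg (ρ α) (suc n))

extend-≡⇒∣-∣≤1 : ∀ x y {a b} → extend x a ≡ extend y b → ℤ.∣ y ℤ.- x ∣ ℕ.≤ 1
extend-≡⇒∣-∣≤1 x y {a} {b} xa≡yb =
  ℕ.*-cancelˡ-≤ 2 (subst (ℕ._≤ 2) ∣a-b∣≡2∣y-x∣ (∣digit-digit∣≤2 a b))
  where
  open ≡-Reasoning
  double-diff : ∀ x y q → + 2 ℤ.* (y ℤ.- x) ≡ (+ 2 ℤ.* y ℤ.+ q) ℤ.- (+ 2 ℤ.* x ℤ.+ q)
  double-diff = solve-∀
  cancel-double : ∀ x p q → (+ 2 ℤ.* x ℤ.+ p) ℤ.- (+ 2 ℤ.* x ℤ.+ q) ≡ p ℤ.- q
  cancel-double = solve-∀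
  2[y-x]≡a-b : + 2 ℤ.* (y ℤ.- x) ≡ digit a ℤ.- digit b
  2[y-x]≡a-b = begin
    + 2 ℤ.* (y ℤ.- x)              ≡⟨ double-diff x y (digit b) ⟩
    extend y b ℤ.- extend x b      ≡⟨ cong (ℤ._- extend x b) xa≡yb ⟨
    extend x a ℤ.- extend x b      ≡⟨ cancel-double x (digit a) (digit b) ⟩
    digit a ℤ.- digit b            ∎
  ∣a-b∣≡2∣y-x∣ : ℤ.∣ digit a ℤ.- digit b ∣ ≡ 2 ℕ.* ℤ.∣ y ℤ.- x ∣
  ∣a-b∣≡2∣y-x∣ = trans (cong ℤ.∣_∣ (sym 2[y-x]≡a-b)) (ℤ.abs-* (+ 2) (y ℤ.- x))

∣N-initSeg-ρ∣≤1 : ∀ α n → ℤ.∣ N (initSeg α (suc n)) ℤ.- N (initSeg (ρ α) (suc n)) ∣ ℕ.≤ 1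
∣N-initSeg-ρ∣≤1 α n =
  extend-≡⇒∣-∣≤1 (N (initSeg (ρ α) (suc n))) (N (initSeg α (suc n))) (ρ-carry-invariant α n)

toℚᵘ-/ : ∀ i d .{{_ : NonZero d}} → toℚᵘ (i / d) ≃ i ℚᵘ./ d
toℚᵘ-/ i (suc d) = ℚ.toℚᵘ-fromℚᵘ (ℚᵘ.mkℚᵘ i d)

toℚᵘ-∣-∣-dist : ∀ p q → toℚᵘ ∣ p - q ∣ ≃ ℚᵘ.∣ toℚᵘ p ℚᵘ.- toℚᵘ q ∣
toℚᵘ-∣-∣-dist p q = ℚᵘ.≃-trans (ℚ.toℚᵘ-homo-∣-∣ (p - q))
  (ℚᵘ.∣-∣-cong (ℚᵘ.≃-trans (ℚ.toℚᵘ-homo-+ p (ℚ.- q)) (ℚᵘ.+-congʳ (toℚᵘ p) (ℚ.toℚᵘ-homo‿- q))))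

∣i/d-j/d∣≤ᵘ1/e : ∀ i j d e .{{_ : NonZero d}} .{{_ : NonZero e}} →
                 ℤ.∣ i ℤ.- j ∣ ℕ.≤ 1 → e ℕ.≤ d → ℚᵘ.∣ i ℚᵘ./ d ℚᵘ.- j ℚᵘ./ d ∣ ≤ᵘ + 1 ℚᵘ./ e
∣i/d-j/d∣≤ᵘ1/e i j d@(suc _) e@(suc _) ∣i-j∣≤1 e≤d = *≤* (begin
  + ℤ.∣ i ℤ.* + d ℤ.+ ℤ.- j ℤ.* + d ∣ ℤ.* + e
    ≡⟨ cong (λ t → + ℤ.∣ t ∣ ℤ.* + e) (ℤ.*-distribʳ-+ (+ d) i (ℤ.- j)) ⟨
  + ℤ.∣ (i ℤ.- j) ℤ.* + d ∣ ℤ.* + e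
    ≡⟨ cong (λ t → + t ℤ.* + e) (ℤ.abs-* (i ℤ.- j) (+ d)) ⟩
  + (ℤ.∣ i ℤ.- j ∣ ℕ.* d) ℤ.* + e
    ≡⟨ ℤ.pos-* (ℤ.∣ i ℤ.- j ∣ ℕ.* d) e ⟨
  + (ℤ.∣ i ℤ.- j ∣ ℕ.* d ℕ.* e)
    ≤⟨ ℤ.+≤+ (ℕ.*-mono-≤ ∣i-j∣d≤d e≤d) ⟩
  + (d ℕ.* d)
    ≡⟨ ℤ.*-identityˡ (+ (d ℕ.* d)) ⟨
  + 1 ℤ.* + (d ℕ.* d)
    ∎)
  where
  open ℤ.≤-Reasoning
  ∣i-j∣d≤d : ℤ.∣ i ℤ.- j ∣ ℕ.* d ℕ.≤ d
  ∣i-j∣d≤d = ℕ.≤-trans (ℕ.*-monoˡ-≤ d ∣i-j∣≤1) (ℕ.≤-reflexive (ℕ.*-identityˡ d))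

∣i/d-j/d∣≤1/e : ∀ i j d e .{{_ : NonZero d}} .{{_ : NonZero e}} →
                ℤ.∣ i ℤ.- j ∣ ℕ.≤ 1 → e ℕ.≤ d → ∣ i / d - j / d ∣ ≤ + 1 / e
∣i/d-j/d∣≤1/e i j d e ∣i-j∣≤1 e≤d = ℚ.toℚᵘ-cancel-≤ (begin
  toℚᵘ ∣ i / d - j / d ∣                    ≃⟨ toℚᵘ-∣-∣-dist (i / d) (j / d) ⟩
  ℚᵘ.∣ toℚᵘ (i / d) ℚᵘ.- toℚᵘ (j / d) ∣     ≃⟨ ℚᵘ.∣-∣-cong (ℚᵘ.+-cong (toℚᵘ-/ i d) (ℚᵘ.-‿cong (toℚᵘ-/ j d))) ⟩
  ℚᵘ.∣ i ℚᵘ./ d ℚᵘ.- j ℚᵘ./ d ∣             ≤⟨ ∣i/d-j/d∣≤ᵘ1/e i j d e ∣i-j∣≤1 e≤d ⟩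
  + 1 ℚᵘ./ e                                ≃⟨ toℚᵘ-/ (+ 1) e ⟨
  toℚᵘ (+ 1 / e)                            ∎)
  where open ℚᵘ.≤-Reasoning

corollary4p9 : (α : ℕ → Trit) → Φ α ≃ℝ Φ (ρ α)
corollary4p9 α n =
  ∣i/d-j/d∣≤1/e (N (initSeg α (suc n))) (N (initSeg (ρ α) (suc n))) (pow2 (2 ℕ.+ n)) (pow2 n)
    {{pow2-nonZero (2 ℕ.+ n)}} {{pow2-nonZero n}}
    (∣N-initSeg-ρ∣≤1 α n) (ℕ.^-monoʳ-≤ 2 (ℕ.m≤n+m n 2))
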